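{- Let the edges of the complete $4$-uniform hypergraph $\mathcal{H}=\mathcal{K}^4_{N}$ be colored red and blue. Let $\mathcal{P}=e_1e_2\ldots e_n$ be a red loose path which is maximal with respect to $W$, where $W\subseteq V(\mathcal{H})\setminus V(\mathcal{P})$ and $|W|\geq 4$. Let $A_1=\{f_{\mathcal{P},e_1}\}$ and $A_i=e_{i-1}\setminus\{f_{\mathcal{P},e_{i-1}}\}$ for $i>1$. Then for every two consecutive edges $e_i,e_{i+1}$ of $\mathcal{P}$ and every $u\in A_i$ there is a blue good $\varpi_S$-configuration $C=fg$ (edges $f=\{x,a_1,a_2,a_3\}$, $g=\{a_3,a_4,a_5,y\}$, $S=\{a_1,\dots,a_5\}$) with end vertices $x\in f$, $y\in g$ in $W$ and $$S\subseteq \Big((e_i\setminus\{f_{\mathcal{P},e_i}\})\cup\{u\}\Big)\cup\Big(e_{i+1}\setminus\{v\}\Big)$$ for some $v\in A_{i+2}$. Moreover, there are subsets $W_1,W_2\subseteq W$ with $|W_1|\geq|W|-2$ and $|W_2|\geq |W|-3$ such that for all distinct $x'\in W_1$ and $y'\in W_2$, the path $C'=\big((f\setminus\{x\})\cup\{x'\}\big)\big((g\setminus\{y\})\cup\{y'\}\big)$ is also a blue good $\varpi_S$-configuration with end vertices $x'$ and $y'$ in $W$.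
   Context: A $4$-uniform loose path $\mathcal{P}=e_1e_2\ldots e_n$ has vertex set $\{v_1,\ldots,v_{3n+1}\}$ and edges $e_i=\{v_{3i-2},v_{3i-1},v_{3i},v_{3i+1}\}$; the first vertex of $e_i$ is $f_{\mathcal{P},e_i}=v_{3i-2}$ and its last vertex is $l_{\mathcal{P},e_i}=v_{3i+1}$. For a loose path $\mathcal{P}$ and a vertex set $W$ disjoint from $V(\mathcal{P})$, a $\varpi_S$-configuration is a copy of the loose path $\mathcal{P}^4_2$ with edges $\{x,a_1,a_2,a_3\},\{a_3,a_4,a_5,y\}$, where $\{x,y\}\subseteq W$ (the end vertices) and $S=\{a_1,\dots,a_5\}\subseteq (e_{j-1}\setminus\{f_{\mathcal{P},e_{j-1}}\})\cup e_j\cup e_{j+1}$ for three consecutive edges of $\mathcal{P}$, with $|S\cap(e_{j-1}\setminus\{f_{\mathcal{P},e_{j-1}}\})|\le 1$; it is good if at least one vertex of $e_{j+1}\setminus e_j$ is not in $S$. A monochromatic loose path $\mathcal{P}=e_1\ldots e_n$ is maximal with respect to $W\subseteq V(\mathcal{H})\setminus V(\mathcal{P})$ if there is no $W'\subseteq W$ such that for some $1\le r\le n$ and $1\le i\le n-r+1$, $\mathcal{P}'=e_1\ldots e_{i-1}e'_ie'_{i+1}\ldots e'_{i+r}e_{i+r}\ldots e_n$ is a monochromatic (same color) loose path with $n+1$ edges satisfying: (i) $V(\mathcal{P}')=V(\mathcal{P})\cup W'$; (ii) if $i=1$ then $f_{\mathcal{P}',e'_i}=f_{\mathcal{P},e_i}$;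 (iii) if $i+r-1=n$ then $l_{\mathcal{P}',e'_{i+r}}=l_{\mathcal{P},e_n}$. -}

module Defs where

open import Data.Nat using (ℕ; zero; suc; _+_; _*_; _∸_; _≤_)
open import Data.Fin using (Fin)
open import Data.Fin.Subset using (Subset; ⊥; ⁅_⁆; _∪_; _∩_; _─_; _∈_; _∉_; _⊆_; ∣_∣)
open import Data.Product using (Σ; _×_; ∃; ∃-syntax)
open import Data.List using (List; []; _∷_)
open import Data.List.Relation.Unary.Unique.Propositional using (Unique)
open import Relation.Binary.PropositionalEquality using (_≡_)
open import Relation.Nullary using (¬_)

data Colour : Set where
  red blue : Colour

-- Edges are the 4-element subsets; the colouring is
-- given on all subsets, only its values on 4-element subsets are ever used.
Colouring : ℕ → Set
Colouring N = Subset N → Colour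

edge4 : ∀ {N} → Fin N → Fin N → Fin N → Fin N → Subset N
edge4 p q r s = ⁅ p ⁆ ∪ (⁅ q ⁆ ∪ (⁅ r ⁆ ∪ ⁅ s ⁆))

-- A loose path with n edges is given by its vertex sequence v_1,...,v_{3n+1}
-- (a function ℕ → Fin N; only the values at 1..3n+1 matter), which must be
-- injective on {1,...,3n+1}.
IsLoosePath : ∀ {N} → ℕ → (ℕ → Fin N) → Set
IsLoosePath n v = ∀ k l → 1 ≤ k → k ≤ 3 * n + 1 → 1 ≤ l → l ≤ 3 * n + 1 →
                  v k ≡ v l → k ≡ l

edge : ∀ {N} → (ℕ → Fin N) → ℕ → Subset N
edge v i = edge4 (v (3 * i ∸ 2)) (v (3 * i ∸ 1)) (v (3 * i)) (v (3 * i + 1))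

firstV : ∀ {N} → (ℕ → Fin N) → ℕ → Fin N
firstV v i = v (3 * i ∸ 2)

lastV : ∀ {N} → (ℕ → Fin N) → ℕ → Fin N
lastV v i = v (3 * i + 1)

points : ∀ {N} → (ℕ → Fin N) → ℕ → Subset N
points v zero    = ⊥
points v (suc m) = ⁅ v (suc m) ⁆ ∪ points v m

vertexSet : ∀ {N} → (ℕ → Fin N) → ℕ → Subset N
vertexSet v n = points v (3 * n + 1)

Monochromatic : ∀ {N} → Colouring N → Colour → ℕ → (ℕ → Fin N) → Set
Monochromatic χ col n v = ∀ i → 1 ≤ i → i ≤ n → χ (edge v i) ≡ col

-- The loose path P' (vertex sequence w, n+1 edges) is an extension of
-- P (vertex sequence v, n edges) as in the definition of maximality,
-- replacing e_i … e_{i+r-1} by e'_i … e'_{i+r}, using W' ⊆ W.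
IsExtension : ∀ {N} → Colouring N → Colour → ℕ → (ℕ → Fin N) → Subset N →
              Subset N → ℕ → ℕ → (ℕ → Fin N) → Set
IsExtension χ col n v W W' r i w =
  W' ⊆ W × 1 ≤ r × r ≤ n × 1 ≤ i × i ≤ n ∸ r + 1 ×
  IsLoosePath (suc n) w × Monochromatic χ col (suc n) w ×
  (∀ j → 1 ≤ j → j + 1 ≤ i → edge w j ≡ edge v j) ×
  (∀ j → i + r ≤ j → j ≤ n → edge w (suc j) ≡ edge v j) ×
  vertexSet w (suc n) ≡ (vertexSet v n ∪ W') ×
  (i ≡ 1 → firstV w i ≡ firstV v i) ×
  (i + r ∸ 1 ≡ n → lastV w (i + r) ≡ lastV v n)

Maximal : ∀ {N} → Colouring N → Colour → ℕ → (ℕ → Fin N) → Subset N → Set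
Maximal χ col n v W =
  ¬ (Σ _ λ W' → Σ ℕ λ r → Σ ℕ λ i → Σ (ℕ → _) λ w → IsExtension χ col n v W W' r i w)

A : ∀ {N} → (ℕ → Fin N) → ℕ → Subset N
A v zero          = ⊥
A v (suc zero)    = ⁅ firstV v 1 ⁆
A v (suc (suc k)) = edge v (suc k) ─ ⁅ firstV v (suc k) ⁆

Sset : ∀ {N} → Fin N → Fin N → Fin N → Fin N → Fin N → Subset N
Sset a1 a2 a3 a4 a5 = ⁅ a1 ⁆ ∪ (⁅ a2 ⁆ ∪ (⁅ a3 ⁆ ∪ (⁅ a4 ⁆ ∪ ⁅ a5 ⁆)))

-- A good ϖ_S-configuration of colour col for the path P (vertex sequence v,
-- n edges) and W, with respect to the consecutive edges e_{j-1}, e_j, e_{j+1}: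
-- the loose path {x,a1,a2,a3}{a3,a4,a5,y} (7 distinct vertices), both edges
-- of colour col, x,y ∈ W, S ⊆ A_j ∪ e_j ∪ e_{j+1}, |S ∩ A_j| ≤ 1, and some
-- vertex of e_{j+1} \ e_j is not in S.  (A_j = e_{j-1} \ {f_{e_{j-1}}} for
-- j ≥ 2; for j = 1 we use A_1 = {f_{e_1}}.)
GoodConfigAt : ∀ {N} → Colouring N → Colour → ℕ → (ℕ → Fin N) → Subset N → ℕ →
               Fin N → Fin N → Fin N → Fin N → Fin N → Fin N → Fin N → Set
GoodConfigAt χ col n v W j x a1 a2 a3 a4 a5 y =
  Unique (x ∷ a1 ∷ a2 ∷ a3 ∷ a4 ∷ a5 ∷ y ∷ []) ×
  x ∈ W × y ∈ W ×
  χ (edge4 x a1 a2 a3) ≡ col × χ (edge4 a3 a4 a5 y) ≡ col ×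
  1 ≤ j × j + 1 ≤ n ×
  Sset a1 a2 a3 a4 a5 ⊆ (A v j ∪ (edge v j ∪ edge v (j + 1))) ×
  ∣ Sset a1 a2 a3 a4 a5 ∩ A v j ∣ ≤ 1 ×
  (∃[ z ] (z ∈ edge v (j + 1) × z ∉ edge v j × z ∉ Sset a1 a2 a3 a4 a5))

GoodConfig : ∀ {N} → Colouring N → Colour → ℕ → (ℕ → Fin N) → Subset N →
             Fin N → Fin N → Fin N → Fin N → Fin N → Fin N → Fin N → Set
GoodConfig χ col n v W x a1 a2 a3 a4 a5 y =
  ∃[ j ] GoodConfigAt χ col n v W j x a1 a2 a3 a4 a5 y

module Submission where

-- Write e_i = v_P … v_{P+3} and e_{i+1} = v_{P+3} … v_{P+6}, and label u, v_{P+1}, …, v_{P+6}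
-- by U, B, …, G.  For a triple T of labels let R(T) be the set of w ∈ W for which {w} ∪ T is red,
-- and call T small when |R(T)| ≤ 2.  If for an ordering x₁ s₁ x₂ s₂ x₃ of B … F the triples
-- {U,x₁,s₁}, {s₁,x₂,s₂}, {s₂,x₃,G} were all large, then distinct w₁ ∈ R(T₁), w₂ ∈ R(T₂),
-- w₃ ∈ R(T₃) would turn e_i e_{i+1} into a red path from u to v_{P+6} with one edge more
-- (preceded by e_{i-1}, read so that it ends in u, when u ≠ v_P), contradicting maximality.
-- Hence each of four such "detours" contains a small triple, and a finite case check shows
-- that two of these four small triples always fit together as {x,a₁,a₂,a₃} {a₃,a₄,a₅,y}
-- leaving out one of E, F, G.  The blue complements of their sets R are the W₁ and W₂.

open import Defs
open import Algebra.Bundles using (CommutativeMonoid)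
import Algebra.Properties.CommutativeSemigroup as CommSemigroupProps
open import Data.Bool using (Bool; true; false)
open import Data.Empty using (⊥-elim)
open import Data.Fin using (Fin; toℕ) renaming (zero to fzero; suc to fsuc)
import Data.Fin.Properties as Fin
open import Data.Fin.Subset using (Subset; ⁅_⁆; _∪_; _∩_; _─_; _∈_; _∉_; _⊆_; ∣_∣; ⋃)
open import Data.Fin.Subset.Properties
open import Data.List using (List; []; _∷_; _++_; map; length)
open import Data.List.Properties using (++-assoc)
open import Data.List.Membership.Propositional using () renaming (_∈_ to _∈ₗ_; _∉_ to _∉ₗ_)
open import Data.List.Membership.Propositional.Properties using (∈-++⁺ˡ; ∈-++⁺ʳ; ∈-++⁻; ∈-map⁻)
open import Data.List.Relation.Unary.All using (All; []; _∷_)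
import Data.List.Relation.Unary.All as All
import Data.List.Relation.Unary.All.Properties as All
open import Data.List.Relation.Unary.AllPairs using ([]; _∷_)
open import Data.List.Relation.Unary.Any using (here; there)
open import Data.List.Relation.Unary.Unique.Propositional using (Unique; head; tail)
import Data.List.Relation.Unary.Unique.Propositional.Properties as Unique
open import Data.List.Relation.Unary.Unique.DecPropositional (Fin._≟_ {7}) using (unique?)
open import Data.List.Relation.Binary.Permutation.Propositional
  using (_↭_; ↭-refl; ↭-prep; ↭-swap; ↭-sym; ↭-trans; ↭⇒↭ₛ; module PermutationReasoning)
import Data.List.Relation.Binary.Permutation.Propositional as ↭
import Data.List.Relation.Binary.Permutation.Propositional.Properties as ↭
open import Data.List.Relation.Binary.Permutation.Setoid.Properties using (Unique-resp-↭)
open import Data.List.Sort.InsertionSort (Fin.≤-decTotalOrder 7) using (sort)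
open import Data.List.Sort.InsertionSort.Properties (Fin.≤-decTotalOrder 7) using (sort-↭)
open import Data.Nat using (ℕ; zero; suc; _+_; _*_; _∸_; _≤_; _<_; z≤n; s≤s; _≤?_; _≟_)
open import Data.Nat.Properties
open import Data.Nat.Tactic.RingSolver using (solve-∀)
open import Data.Product using (Σ; _×_; _,_; proj₁; proj₂; ∃-syntax; uncurry)
open import Data.Sum using (_⊎_; inj₁; inj₂; [_,_]′)
open import Data.Vec using (tabulate)
import Data.Vec as Vec
open import Data.Vec.Properties using (lookup∘tabulate; []=⇒lookup; lookup⇒[]=)
open import Function using (_∘_)
open import Relation.Binary.PropositionalEquality
import Relation.Binary.PropositionalEquality as ≡
open import Relation.Nullary using (¬_; Dec; yes; no)
open import Relation.Nullary.Decidable using (True; toWitness)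

∣p∪q∣≤∣p∣+∣q∣ : ∀ {n} (p q : Subset n) → ∣ p ∪ q ∣ ≤ ∣ p ∣ + ∣ q ∣
∣p∪q∣≤∣p∣+∣q∣ Vec.[]          Vec.[]          = z≤n
∣p∪q∣≤∣p∣+∣q∣ (true Vec.∷ p)  (true Vec.∷ q)  = s≤s (≤-trans (∣p∪q∣≤∣p∣+∣q∣ p q) (≤-trans (n≤1+n _) (≤-reflexive (sym (+-suc _ _)))))
∣p∪q∣≤∣p∣+∣q∣ (true Vec.∷ p)  (false Vec.∷ q) = s≤s (∣p∪q∣≤∣p∣+∣q∣ p q)
∣p∪q∣≤∣p∣+∣q∣ (false Vec.∷ p) (true Vec.∷ q)  = ≤-trans (s≤s (∣p∪q∣≤∣p∣+∣q∣ p q)) (≤-reflexive (sym (+-suc _ _)))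
∣p∪q∣≤∣p∣+∣q∣ (false Vec.∷ p) (false Vec.∷ q) = ∣p∪q∣≤∣p∣+∣q∣ p q

x∈p─q⇒x∉q : ∀ {n} {x : Fin n} (p q : Subset n) → x ∈ p ─ q → x ∉ q
x∈p─q⇒x∉q (true Vec.∷ p) (false Vec.∷ q) Vec.here       = λ ()
x∈p─q⇒x∉q (_ Vec.∷ p)    (true Vec.∷ q)  (Vec.there x∈) = λ { (Vec.there x∈q) → x∈p─q⇒x∉q p q x∈ x∈q }
x∈p─q⇒x∉q (_ Vec.∷ p)    (false Vec.∷ q) (Vec.there x∈) = λ { (Vec.there x∈q) → x∈p─q⇒x∉q p q x∈ x∈q }

x∈p─q⁻ : ∀ {n} {x : Fin n} (p q : Subset n) → x ∈ p ─ q → x ∈ p × x ∉ q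
x∈p─q⁻ p q x∈ = p─q⊆p p q x∈ , x∈p─q⇒x∉q p q x∈

∣q∣<∣p∣⇒∃∈p∉q : ∀ {n} (p q : Subset n) → ∣ q ∣ < ∣ p ∣ → ∃[ z ] z ∈ p × z ∉ q
∣q∣<∣p∣⇒∃∈p∉q p q ∣q∣<∣p∣ with nonempty? (p ─ q)
... | yes (z , z∈p─q) = z , x∈p─q⁻ p q z∈p─q
... | no p─q-empty    = ⊥-elim (<⇒≱ ∣q∣<∣p∣ (p⊆q⇒∣p∣≤∣q∣ p⊆q))
  where
  p⊆q : p ⊆ q
  p⊆q {x} x∈p with x ∈? q
  ... | yes x∈q = x∈q
  ... | no  x∉q = ⊥-elim (p─q-empty (x , x∈p∧x∉q⇒x∈p─q x∈p x∉q))

∪-left-comm : ∀ {n} (p q r : Subset n) → p ∪ (q ∪ r) ≡ q ∪ (p ∪ r)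
∪-left-comm {n} = x∙yz≈y∙xz
  where open CommSemigroupProps (CommutativeMonoid.commutativeSemigroup (∪-commutativeMonoid n))

setOf : ∀ {n} → List (Fin n) → Subset n
setOf xs = ⋃ (map ⁅_⁆ xs)

∈setOf⁺ : ∀ {n} {x : Fin n} {xs} → x ∈ₗ xs → x ∈ setOf xs
∈setOf⁺ (here refl) = x∈p∪q⁺ (inj₁ (x∈⁅x⁆ _))
∈setOf⁺ (there x∈)  = x∈p∪q⁺ (inj₂ (∈setOf⁺ x∈))

∈setOf⁻ : ∀ {n} {x : Fin n} xs → x ∈ setOf xs → x ∈ₗ xs
∈setOf⁻ []       x∈ = ⊥-elim (∉⊥ x∈)
∈setOf⁻ (y ∷ xs) x∈ with x∈p∪q⁻ ⁅ y ⁆ (setOf xs) x∈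
... | inj₁ x∈⁅y⁆ = here (x∈⁅y⁆⇒x≡y y x∈⁅y⁆)
... | inj₂ x∈xs  = there (∈setOf⁻ xs x∈xs)

∣setOf∣≤length : ∀ {n} (xs : List (Fin n)) → ∣ setOf xs ∣ ≤ length xs
∣setOf∣≤length {n} []   = ≤-reflexive (∣⊥∣≡0 n)
∣setOf∣≤length (x ∷ xs) = ≤-trans (∣p∪q∣≤∣p∣+∣q∣ ⁅ x ⁆ (setOf xs))
                                  (+-mono-≤ (≤-reflexive (∣⁅x⁆∣≡1 x)) (∣setOf∣≤length xs))

∃∈p∉ₗ : ∀ {n} (p : Subset n) xs → length xs < ∣ p ∣ → ∃[ z ] z ∈ p × z ∉ₗ xs
∃∈p∉ₗ p xs short with ∣q∣<∣p∣⇒∃∈p∉q p (setOf xs) (≤-<-trans (∣setOf∣≤length xs) short)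
... | z , z∈p , z∉xs = z , z∈p , λ z∈ₗxs → z∉xs (∈setOf⁺ z∈ₗxs)

setOf-↭ : ∀ {n} {xs ys : List (Fin n)} → xs ↭ ys → setOf xs ≡ setOf ys
setOf-↭ ↭.refl                  = refl
setOf-↭ (↭.prep x xs↭ys)        = cong (⁅ x ⁆ ∪_) (setOf-↭ xs↭ys)
setOf-↭ (↭.swap x y xs↭ys)      = trans (∪-left-comm ⁅ x ⁆ ⁅ y ⁆ _) (cong (λ s → ⁅ y ⁆ ∪ (⁅ x ⁆ ∪ s)) (setOf-↭ xs↭ys))
setOf-↭ (↭.trans xs↭ys ys↭zs)   = trans (setOf-↭ xs↭ys) (setOf-↭ ys↭zs)

unique-between : ∀ {n} {W : Subset n} {x y} (zs : List (Fin n)) → Unique zs → All (_∉ W) zs →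
                 x ∈ W → y ∈ W → x ≢ y → Unique (x ∷ zs ++ y ∷ [])
unique-between {W = W} zs zs-unique zs∉W x∈W y∈W x≢y =
  All.++⁺ (All.map (λ z∉W x≡z → z∉W (subst (_∈ W) x≡z x∈W)) zs∉W) (x≢y ∷ [])
  ∷ Unique.++⁺ zs-unique ([] ∷ []) λ { (z∈zs , here refl) → All.lookup zs∉W z∈zs y∈W }

∈edge4⁻ : ∀ {n} {z p q r s : Fin n} → z ∈ edge4 p q r s → z ≡ p ⊎ z ≡ q ⊎ z ≡ r ⊎ z ≡ s
∈edge4⁻ {p = p} {q} {r} {s} z∈ with x∈p∪q⁻ ⁅ p ⁆ _ z∈
... | inj₁ z∈p = inj₁ (x∈⁅y⁆⇒x≡y p z∈p)
... | inj₂ z∈ with x∈p∪q⁻ ⁅ q ⁆ _ z∈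
... | inj₁ z∈q = inj₂ (inj₁ (x∈⁅y⁆⇒x≡y q z∈q))
... | inj₂ z∈ with x∈p∪q⁻ ⁅ r ⁆ _ z∈
... | inj₁ z∈r = inj₂ (inj₂ (inj₁ (x∈⁅y⁆⇒x≡y r z∈r)))
... | inj₂ z∈s = inj₂ (inj₂ (inj₂ (x∈⁅y⁆⇒x≡y s z∈s)))

∈edge4⁺ : ∀ {n} {z p q r s : Fin n} → z ≡ p ⊎ z ≡ q ⊎ z ≡ r ⊎ z ≡ s → z ∈ edge4 p q r s
∈edge4⁺ (inj₁ refl)                = x∈p∪q⁺ (inj₁ (x∈⁅x⁆ _))
∈edge4⁺ (inj₂ (inj₁ refl))         = x∈p∪q⁺ (inj₂ (x∈p∪q⁺ (inj₁ (x∈⁅x⁆ _))))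
∈edge4⁺ (inj₂ (inj₂ (inj₁ refl)))  = x∈p∪q⁺ (inj₂ (x∈p∪q⁺ (inj₂ (x∈p∪q⁺ (inj₁ (x∈⁅x⁆ _))))))
∈edge4⁺ (inj₂ (inj₂ (inj₂ refl)))  = x∈p∪q⁺ (inj₂ (x∈p∪q⁺ (inj₂ (x∈p∪q⁺ (inj₂ (x∈⁅x⁆ _))))))

edge4≡setOf : ∀ {n} (a b c d : Fin n) → edge4 a b c d ≡ setOf (a ∷ b ∷ c ∷ d ∷ [])
edge4≡setOf a b c d = cong (λ s → ⁅ a ⁆ ∪ (⁅ b ⁆ ∪ (⁅ c ⁆ ∪ s))) (sym (∪-identityʳ ⁅ d ⁆))

edge4-↭ : ∀ {n} {a b c d a′ b′ c′ d′ : Fin n} →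
          (a ∷ b ∷ c ∷ d ∷ []) ↭ (a′ ∷ b′ ∷ c′ ∷ d′ ∷ []) → edge4 a b c d ≡ edge4 a′ b′ c′ d′
edge4-↭ {a = a} {b} {c} {d} {a′} {b′} {c′} {d′} σ =
  trans (edge4≡setOf a b c d) (trans (setOf-↭ σ) (sym (edge4≡setOf a′ b′ c′ d′)))

edge4-cong : ∀ {N} {a a′ b b′ c c′ d d′ : Fin N} →
             a ≡ a′ → b ≡ b′ → c ≡ c′ → d ≡ d′ → edge4 a b c d ≡ edge4 a′ b′ c′ d′
edge4-cong refl refl refl refl = refl

Sset≡setOf : ∀ {n} (a b c d e : Fin n) → Sset a b c d e ≡ setOf (a ∷ b ∷ c ∷ d ∷ e ∷ [])
Sset≡setOf a b c d e = cong (λ s → ⁅ a ⁆ ∪ (⁅ b ⁆ ∪ (⁅ c ⁆ ∪ (⁅ d ⁆ ∪ s)))) (sym (∪-identityʳ ⁅ e ⁆))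

∈Sset⁻ : ∀ {n} {z : Fin n} a b c d e → z ∈ Sset a b c d e → z ∈ₗ (a ∷ b ∷ c ∷ d ∷ e ∷ [])
∈Sset⁻ {z = z} a b c d e z∈ = ∈setOf⁻ _ (subst (z ∈_) (Sset≡setOf a b c d e) z∈)

module _ {A : Set} where

  segment : (ℕ → A) → ℕ → ℕ → List A
  segment f s zero    = []
  segment f s (suc l) = f (suc s) ∷ segment f (suc s) l

  segment-++ : ∀ (f : ℕ → A) s a b → segment f s (a + b) ≡ segment f s a ++ segment f (s + a) b
  segment-++ f s zero    b rewrite +-identityʳ s = refl
  segment-++ f s (suc a) b rewrite segment-++ f (suc s) a b | +-suc s a = refl

  ∈-segment⁻ : ∀ (f : ℕ → A) s l {x} → x ∈ₗ segment f s l → ∃[ k ] s < k × k ≤ s + l × f k ≡ x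
  ∈-segment⁻ f s (suc l) (here refl) = suc s , ≤-refl , m<m+n s (s≤s z≤n) , refl
  ∈-segment⁻ f s (suc l) (there x∈) with ∈-segment⁻ f (suc s) l x∈
  ... | k , s<k , k≤ , refl = k , <-trans (n<1+n s) s<k , ≤-trans k≤ (≤-reflexive (sym (+-suc s l))) , refl

  ∈-segment⁺ : ∀ (f : ℕ → A) s l k → s < k → k ≤ s + l → f k ∈ₗ segment f s l
  ∈-segment⁺ f s zero    k s<k k≤s+0 = ⊥-elim (<⇒≱ s<k (≤-trans k≤s+0 (≤-reflexive (+-identityʳ s))))
  ∈-segment⁺ f s (suc l) k s<k k≤ with k ≟ suc s
  ... | yes refl = here refl
  ... | no k≢1+s = there (∈-segment⁺ f (suc s) l k (≤∧≢⇒< s<k (k≢1+s ∘ sym)) (≤-trans k≤ (≤-reflexive (+-suc s l))))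

  segment-cong : ∀ (f g : ℕ → A) s t l → (∀ j → 1 ≤ j → j ≤ l → f (s + j) ≡ g (t + j)) →
                 segment f s l ≡ segment g t l
  segment-cong f g s t zero    f≗g = refl
  segment-cong f g s t (suc l) f≗g = cong₂ _∷_ head-eq (segment-cong f g (suc s) (suc t) l tail-eq)
    where
    head-eq : f (suc s) ≡ g (suc t)
    head-eq = trans (cong f (+-comm 1 s)) (trans (f≗g 1 ≤-refl (s≤s z≤n)) (cong g (+-comm t 1)))
    tail-eq : ∀ j → 1 ≤ j → j ≤ l → f (suc s + j) ≡ g (suc t + j)
    tail-eq j 1≤j j≤l = trans (cong f (sym (+-suc s j))) (trans (f≗g (suc j) (s≤s z≤n) (s≤s j≤l)) (cong g (+-suc t j)))

  InjectiveOn : (ℕ → A) → ℕ → ℕ → Set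
  InjectiveOn f s l = ∀ k k′ → s < k → k ≤ s + l → s < k′ → k′ ≤ s + l → f k ≡ f k′ → k ≡ k′

  tail-bounds : ∀ {s l k} → s < k → k ≤ s + suc l → k ≢ suc s → suc s < k × k ≤ suc s + l
  tail-bounds {s} {l} s<k k≤ k≢ = ≤∧≢⇒< s<k (k≢ ∘ sym) , ≤-trans k≤ (≤-reflexive (+-suc s l))

  injectiveOn⇒unique : ∀ (f : ℕ → A) s l → InjectiveOn f s l → Unique (segment f s l)
  injectiveOn⇒unique f s zero    inj = []
  injectiveOn⇒unique f s (suc l) inj = All.¬Any⇒All¬ _ head-fresh ∷ injectiveOn⇒unique f (suc s) l tail-inj
    where
    widen : ∀ {k} → suc s < k → k ≤ suc s + l → s < k × k ≤ s + suc l
    widen 1+s<k k≤ = <-trans (n<1+n s) 1+s<k , ≤-trans k≤ (≤-reflexive (sym (+-suc s l)))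
    tail-inj : InjectiveOn f (suc s) l
    tail-inj k k′ 1+s<k k≤ 1+s<k′ k′≤ = uncurry (uncurry (inj k k′) (widen 1+s<k k≤)) (widen 1+s<k′ k′≤)
    head-fresh : f (suc s) ∉ₗ segment f (suc s) l
    head-fresh x∈ with ∈-segment⁻ f (suc s) l x∈
    ... | k , 1+s<k , k≤ , fk≡ = <-irrefl (uncurry (inj (suc s) k ≤-refl (m<m+n s (s≤s z≤n))) (widen 1+s<k k≤) (sym fk≡)) 1+s<k

  unique⇒injectiveOn : ∀ (f : ℕ → A) s l → Unique (segment f s l) → InjectiveOn f s l
  unique⇒injectiveOn f s zero    _ k _ s<k k≤ _ _ _ = ⊥-elim (<⇒≱ s<k (≤-trans k≤ (≤-reflexive (+-identityʳ s))))
  unique⇒injectiveOn f s (suc l) (fresh ∷ uniq) k k′ s<k k≤ s<k′ k′≤ fk≡fk′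
    with k ≟ suc s | k′ ≟ suc s
  ... | yes refl | yes refl = refl
  ... | yes refl | no k′≢   = ⊥-elim (All.lookup fresh (uncurry (∈-segment⁺ f (suc s) l k′) (tail-bounds s<k′ k′≤ k′≢)) fk≡fk′)
  ... | no k≢   | yes refl  = ⊥-elim (All.lookup fresh (uncurry (∈-segment⁺ f (suc s) l k) (tail-bounds s<k k≤ k≢)) (sym fk≡fk′))
  ... | no k≢   | no k′≢    =
    uncurry (uncurry (unique⇒injectiveOn f (suc s) l uniq k k′) (tail-bounds s<k k≤ k≢)) (tail-bounds s<k′ k′≤ k′≢) fk≡fk′

∈points⁻ : ∀ {N} (f : ℕ → Fin N) m {x} → x ∈ points f m → ∃[ k ] 0 < k × k ≤ m × f k ≡ x
∈points⁻ f zero    x∈ = ⊥-elim (∉⊥ x∈)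
∈points⁻ f (suc m) x∈ with x∈p∪q⁻ ⁅ f (suc m) ⁆ (points f m) x∈
... | inj₁ x∈⁅fm⁆ = suc m , s≤s z≤n , ≤-refl , sym (x∈⁅y⁆⇒x≡y _ x∈⁅fm⁆)
... | inj₂ x∈ps with ∈points⁻ f m x∈ps
... | k , 0<k , k≤m , fk≡x = k , 0<k , m≤n⇒m≤1+n k≤m , fk≡x

∈points⁺ : ∀ {N} (f : ℕ → Fin N) m k → 0 < k → k ≤ m → f k ∈ points f m
∈points⁺ f zero    k 0<k k≤0 = ⊥-elim (<⇒≱ 0<k k≤0)
∈points⁺ f (suc m) k 0<k k≤ with k ≟ suc m
... | yes refl = x∈p∪q⁺ (inj₁ (x∈⁅x⁆ _))
... | no k≢    = x∈p∪q⁺ (inj₂ (∈points⁺ f m k 0<k (≤-pred (≤∧≢⇒< k≤ k≢))))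

∈points⇒∈segment : ∀ {N} (f : ℕ → Fin N) m {x} → x ∈ points f m → x ∈ₗ segment f 0 m
∈points⇒∈segment f m x∈ with ∈points⁻ f m x∈
... | k , 0<k , k≤m , refl = ∈-segment⁺ f 0 m k 0<k k≤m

∈segment⇒∈points : ∀ {N} (f : ℕ → Fin N) m {x} → x ∈ₗ segment f 0 m → x ∈ points f m
∈segment⇒∈points f m x∈ with ∈-segment⁻ f 0 m x∈
... | k , 0<k , k≤m , refl = ∈points⁺ f m k 0<k k≤m

edge-suc : ∀ {N} (f : ℕ → Fin N) k →
           edge f (suc k) ≡ edge4 (f (1 + 3 * k)) (f (2 + 3 * k)) (f (3 + 3 * k)) (f (4 + 3 * k))
edge-suc f k = trans (cong (λ j → edge4 (f (j ∸ 2)) (f (j ∸ 1)) (f j) (f (j + 1))) (*-suc 3 k))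
                     (cong (λ j → edge4 (f (1 + 3 * k)) (f (2 + 3 * k)) (f (3 + 3 * k)) (f (3 + j))) (+-comm (3 * k) 1))

1+3[1+k]≡4+3k : ∀ k → suc (3 * suc k) ≡ 4 + 3 * k
1+3[1+k]≡4+3k k = cong suc (*-suc 3 k)

firstV-suc : ∀ {N} (v : ℕ → Fin N) k → firstV v (suc k) ≡ v (suc (3 * k))
firstV-suc v k = cong (λ j → v (j ∸ 2)) (*-suc 3 k)

edge-suc-cong : ∀ {N} (f g : ℕ → Fin N) j j′ →
                (∀ s → 1 ≤ s → s ≤ 4 → f (s + 3 * j) ≡ g (s + 3 * j′)) → edge f (suc j) ≡ edge g (suc j′)
edge-suc-cong f g j j′ f≗g = begin
  edge f (suc j)                                                          ≡⟨ edge-suc f j ⟩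
  edge4 (f (1 + 3 * j)) (f (2 + 3 * j)) (f (3 + 3 * j)) (f (4 + 3 * j))     ≡⟨ edge4-cong (at 1) (at 2) (at 3) (at 4) ⟩
  edge4 (g (1 + 3 * j′)) (g (2 + 3 * j′)) (g (3 + 3 * j′)) (g (4 + 3 * j′)) ≡⟨ edge-suc g j′ ⟨
  edge g (suc j′)                                                         ∎
  where
  open ≡-Reasoning
  at : ∀ s {s≥1 : True (1 ≤? s)} {s≤4 : True (s ≤? 4)} → f (s + 3 * j) ≡ g (s + 3 * j′)
  at s {s≥1} {s≤4} = f≗g s (toWitness s≥1) (toWitness s≤4)

module _ {N} (v : ℕ → Fin N) (k : ℕ) where

  edge-next : edge v (suc k + 1) ≡ edge4 (v (4 + 3 * k)) (v (5 + 3 * k)) (v (6 + 3 * k)) (v (7 + 3 * k))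
  edge-next = begin
    edge v (suc k + 1)   ≡⟨ cong (edge v) (+-comm (suc k) 1) ⟩
    edge v (suc (suc k)) ≡⟨ edge-suc v (suc k) ⟩
    edge4 (v (1 + 3 * suc k)) (v (2 + 3 * suc k)) (v (3 + 3 * suc k)) (v (4 + 3 * suc k))
      ≡⟨ cong (λ j → edge4 (v (1 + j)) (v (2 + j)) (v (3 + j)) (v (4 + j))) (*-suc 3 k) ⟩
    edge4 (v (4 + 3 * k)) (v (5 + 3 * k)) (v (6 + 3 * k)) (v (7 + 3 * k)) ∎
    where open ≡-Reasoning

  A-next : A v (suc k + 2) ≡ edge v (suc k + 1) ─ ⁅ v (4 + 3 * k) ⁆
  A-next = begin
    A v (suc k + 2)                                       ≡⟨ cong (A v) (+-comm (suc k) 2) ⟩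
    edge v (suc (suc k)) ─ ⁅ firstV v (suc (suc k)) ⁆      ≡⟨ cong₂ (λ e f → e ─ ⁅ f ⁆) (cong (edge v) (+-comm 1 (suc k))) first≡ ⟩
    edge v (suc k + 1) ─ ⁅ v (4 + 3 * k) ⁆                ∎
    where
    open ≡-Reasoning
    first≡ : firstV v (suc (suc k)) ≡ v (4 + 3 * k)
    first≡ = trans (firstV-suc v (suc k)) (cong v (1+3[1+k]≡4+3k k))

edge⊆points : ∀ {N} (v : ℕ → Fin N) k → edge v (suc k) ⊆ points v (4 + 3 * k)
edge⊆points v k z∈ with ∈edge4⁻ (subst (_ ∈_) (edge-suc v k) z∈)
... | inj₁ refl               = ∈points⁺ v _ _ (s≤s z≤n) (+-monoˡ-≤ (3 * k) {1} {4} (s≤s z≤n))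
... | inj₂ (inj₁ refl)        = ∈points⁺ v _ _ (s≤s z≤n) (+-monoˡ-≤ (3 * k) {2} {4} (s≤s (s≤s z≤n)))
... | inj₂ (inj₂ (inj₁ refl)) = ∈points⁺ v _ _ (s≤s z≤n) (+-monoˡ-≤ (3 * k) {3} {4} (s≤s (s≤s (s≤s z≤n))))
... | inj₂ (inj₂ (inj₂ refl)) = ∈points⁺ v _ _ (s≤s z≤n) ≤-refl

A⊆points : ∀ {N} (v : ℕ → Fin N) k → A v (suc k) ⊆ points v (suc (3 * k))
A⊆points v zero    z∈A rewrite x∈⁅y⁆⇒x≡y _ z∈A = ∈points⁺ v 1 1 ≤-refl ≤-refl
A⊆points v (suc k) {z} z∈A = subst (λ m → z ∈ points v m) (sym (1+3[1+k]≡4+3k k)) (edge⊆points v k (p─q⊆p _ _ z∈A))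

-- Splicing a longer red path into P

module Splice {N} (χ : Colouring N) (n : ℕ) (v : ℕ → Fin N) (W : Subset N)
  (path : IsLoosePath n v) (mono : Monochromatic χ red n v)
  (W-fresh : ∀ z → z ∈ W → z ∉ vertexSet v n)
  (k r : ℕ) (fits : k + suc r ≤ n)
  (ws : List (Fin N)) (ws-unique : Unique ws) (ws⊆W : ∀ {z} → z ∈ₗ ws → z ∈ W)
  -- sq 0 … sq (6 + 3r) is a red path of r + 2 edges replacing e_{k+1} … e_{k+r+1}.
  (sq : ℕ → Fin N)
  (sq-start : sq 0 ≡ v (suc (3 * k)))
  (sq-end : sq (6 + 3 * r) ≡ v (suc (3 * k) + (3 + 3 * r)))
  (sq-interior : segment sq 0 (5 + 3 * r) ↭ segment v (suc (3 * k)) (2 + 3 * r) ++ ws)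
  (sq-red : ∀ t → t ≤ suc r →
            χ (edge4 (sq (3 * t)) (sq (3 * t + 1)) (sq (3 * t + 2)) (sq (3 * t + 3))) ≡ red)
  where

  L K M S : ℕ
  L = suc (3 * k)
  K = 2 + 3 * r
  M = 3 + K
  S = (3 * n + 1) ∸ (L + K)

  w : ℕ → Fin N
  w j with j ≤? L
  ... | yes _ = v j
  ... | no _ with j ≤? L + M
  ...   | yes _ = sq (j ∸ L)
  ...   | no _  = v (j ∸ 3)

  w-before : ∀ j → j ≤ L → w j ≡ v j
  w-before j j≤L with j ≤? L
  ... | yes _  = refl
  ... | no j≰L = ⊥-elim (j≰L j≤L)

  w-inside : ∀ j → L < j → j ≤ L + M → w j ≡ sq (j ∸ L)
  w-inside j L<j j≤ with j ≤? L
  ... | yes j≤L = ⊥-elim (<⇒≱ L<j j≤L)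
  ... | no _ with j ≤? L + M
  ...   | yes _ = refl
  ...   | no j≰ = ⊥-elim (j≰ j≤)

  w-after : ∀ j → L + M < j → w j ≡ v (j ∸ 3)
  w-after j L+M<j with j ≤? L
  ... | yes j≤L = ⊥-elim (<⇒≱ L+M<j (≤-trans j≤L (m≤m+n L M)))
  ... | no _ with j ≤? L + M
  ...   | yes j≤ = ⊥-elim (<⇒≱ L+M<j j≤)
  ...   | no _   = refl

  w-at : ∀ q → q ≤ suc M → w (L + q) ≡ sq q
  w-at zero _ = begin
    w (L + 0)  ≡⟨ w-before (L + 0) (≤-reflexive (+-identityʳ L)) ⟩
    v (L + 0)  ≡⟨ cong v (+-identityʳ L) ⟩
    v L        ≡⟨ sq-start ⟨
    sq 0       ∎
    where open ≡-Reasoning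
  w-at (suc q) q≤ with suc q ≤? M
  ... | yes q<M = trans (w-inside (L + suc q) (m<m+n L (s≤s z≤n)) (+-monoʳ-≤ L q<M)) (cong sq (m+n∸m≡n L (suc q)))
  ... | no q≮M with ≤-antisym q≤ (≰⇒> q≮M)
  ... | refl = begin
    w (L + suc M)                ≡⟨ w-after (L + suc M) (+-monoʳ-< L (n<1+n M)) ⟩
    v (L + suc M ∸ 3)            ≡⟨ cong (λ j → v (j ∸ 3)) (shift-end k r) ⟩
    v (L + (3 + 3 * r) + 3 ∸ 3)  ≡⟨ cong v (m+n∸n≡m (L + (3 + 3 * r)) 3) ⟩
    v (L + (3 + 3 * r))          ≡⟨ sq-end ⟨
    sq (suc M)                   ∎
    where
    open ≡-Reasoning
    shift-end : ∀ k r → suc (3 * k) + (6 + 3 * r) ≡ suc (3 * k) + (3 + 3 * r) + 3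
    shift-end = solve-∀

  L+K≤3n+1 : L + K ≤ 3 * n + 1
  L+K≤3n+1 = begin
    suc (3 * k) + (2 + 3 * r)  ≡⟨ stretch-end k r ⟩
    3 * (k + suc r)            ≤⟨ *-monoʳ-≤ 3 fits ⟩
    3 * n                      ≤⟨ m≤m+n (3 * n) 1 ⟩
    3 * n + 1                  ∎
    where
    open ≤-Reasoning
    stretch-end : ∀ k r → suc (3 * k) + (2 + 3 * r) ≡ 3 * (k + suc r)
    stretch-end = solve-∀

  length-spliced : 3 * suc n + 1 ≡ L + M + S
  length-spliced = begin
    3 * suc n + 1      ≡⟨ three-more n ⟩
    3 * n + 1 + 3      ≡⟨ cong (_+ 3) (m+[n∸m]≡n L+K≤3n+1) ⟨
    L + K + S + 3      ≡⟨ move-3 L K S ⟩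
    L + (3 + K) + S    ∎
    where
    open ≡-Reasoning
    three-more : ∀ n → 3 * suc n + 1 ≡ 3 * n + 1 + 3
    three-more = solve-∀
    move-3 : ∀ a b c → a + b + c + 3 ≡ a + (3 + b) + c
    move-3 = solve-∀

  segment-w : segment w 0 (L + M + S) ≡ segment v 0 L ++ (segment sq 0 M ++ segment v (L + K) S)
  segment-w = begin
    segment w 0 (L + M + S)                                          ≡⟨ segment-++ w 0 (L + M) S ⟩
    segment w 0 (L + M) ++ segment w (L + M) S                       ≡⟨ cong (_++ segment w (L + M) S) (segment-++ w 0 L M) ⟩
    (segment w 0 L ++ segment w L M) ++ segment w (L + M) S          ≡⟨ ++-assoc (segment w 0 L) _ _ ⟩
    segment w 0 L ++ (segment w L M ++ segment w (L + M) S)          ≡⟨ cong₂ _++_ before (cong₂ _++_ inside after) ⟩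
    segment v 0 L ++ (segment sq 0 M ++ segment v (L + K) S)         ∎
    where
    open ≡-Reasoning
    before : segment w 0 L ≡ segment v 0 L
    before = segment-cong w v 0 0 L (λ j _ j≤L → w-before j j≤L)
    inside : segment w L M ≡ segment sq 0 M
    inside = segment-cong w sq L 0 M λ j 1≤j j≤M →
      trans (w-inside (L + j) (m<m+n L 1≤j) (+-monoʳ-≤ L j≤M)) (cong sq (m+n∸m≡n L j))
    after : segment w (L + M) S ≡ segment v (L + K) S
    after = segment-cong w v (L + M) (L + K) S λ j 1≤j _ →
      trans (w-after (L + M + j) (m<m+n (L + M) 1≤j)) (cong v (shift-back L K j))
      where
      shift-back : ∀ a b c → a + (3 + b) + c ∸ 3 ≡ a + b + c
      shift-back a b c = trans (cong (_∸ 3) (move-3 a b c)) (m+n∸n≡m (a + b + c) 3)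
        where
        move-3 : ∀ a b c → a + (3 + b) + c ≡ a + b + c + 3
        move-3 = solve-∀

  segment-v : segment v 0 (3 * n + 1) ≡ segment v 0 L ++ (segment v L K ++ segment v (L + K) S)
  segment-v = begin
    segment v 0 (3 * n + 1)                                  ≡⟨ cong (segment v 0) (m+[n∸m]≡n L+K≤3n+1) ⟨
    segment v 0 (L + K + S)                                  ≡⟨ segment-++ v 0 (L + K) S ⟩
    segment v 0 (L + K) ++ segment v (L + K) S               ≡⟨ cong (_++ segment v (L + K) S) (segment-++ v 0 L K) ⟩
    (segment v 0 L ++ segment v L K) ++ segment v (L + K) S  ≡⟨ ++-assoc (segment v 0 L) _ _ ⟩
    segment v 0 L ++ (segment v L K ++ segment v (L + K) S)  ∎
    where open ≡-Reasoning

  segment-w↭ : segment w 0 (3 * suc n + 1) ↭ segment v 0 (3 * n + 1) ++ ws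
  segment-w↭ = begin
    segment w 0 (3 * suc n + 1)      ≡⟨ cong (segment w 0) length-spliced ⟩
    segment w 0 (L + M + S)          ≡⟨ segment-w ⟩
    Pre ++ (segment sq 0 M ++ Post)  ↭⟨ ↭.++⁺ˡ Pre (↭.++⁺ʳ Post sq-interior) ⟩
    Pre ++ ((Mid ++ ws) ++ Post)     ≡⟨ cong (Pre ++_) (++-assoc Mid ws Post) ⟩
    Pre ++ (Mid ++ (ws ++ Post))     ↭⟨ ↭.++⁺ˡ Pre (↭.++⁺ˡ Mid (↭.++-comm ws Post)) ⟩
    Pre ++ (Mid ++ (Post ++ ws))     ≡⟨ cong (Pre ++_) (++-assoc Mid Post ws) ⟨
    Pre ++ ((Mid ++ Post) ++ ws)     ≡⟨ ++-assoc Pre (Mid ++ Post) ws ⟨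
    (Pre ++ (Mid ++ Post)) ++ ws     ≡⟨ cong (_++ ws) segment-v ⟨
    segment v 0 (3 * n + 1) ++ ws    ∎
    where
    open PermutationReasoning
    Pre  = segment v 0 L
    Mid  = segment v L K
    Post = segment v (L + K) S

  w-path : IsLoosePath (suc n) w
  w-path = unique⇒injectiveOn w 0 (3 * suc n + 1) (Unique-resp-↭ (≡.setoid _) (↭⇒↭ₛ (↭-sym segment-w↭)) old+ws-unique)
    where
    old+ws-unique : Unique (segment v 0 (3 * n + 1) ++ ws)
    old+ws-unique = Unique.++⁺ (injectiveOn⇒unique v 0 (3 * n + 1) path) ws-unique
      λ (x∈old , x∈ws) → W-fresh _ (ws⊆W x∈ws) (∈segment⇒∈points v (3 * n + 1) x∈old)

  w-vertices : vertexSet w (suc n) ≡ vertexSet v n ∪ setOf ws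
  w-vertices = ⊆-antisym new⊆old∪ws old∪ws⊆new
    where
    new⊆old∪ws : vertexSet w (suc n) ⊆ vertexSet v n ∪ setOf ws
    new⊆old∪ws x∈ with ∈-++⁻ (segment v 0 (3 * n + 1)) (↭.∈-resp-↭ segment-w↭ (∈points⇒∈segment w _ x∈))
    ... | inj₁ x∈old = x∈p∪q⁺ (inj₁ (∈segment⇒∈points v _ x∈old))
    ... | inj₂ x∈ws  = x∈p∪q⁺ (inj₂ (∈setOf⁺ x∈ws))
    old∪ws⊆new : vertexSet v n ∪ setOf ws ⊆ vertexSet w (suc n)
    old∪ws⊆new x∈ = ∈segment⇒∈points w _ (↭.∈-resp-↭ (↭-sym segment-w↭) x∈old++ws)
      where
      x∈old++ws : _ ∈ₗ segment v 0 (3 * n + 1) ++ ws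
      x∈old++ws = [ (λ x∈old → ∈-++⁺ˡ (∈points⇒∈segment v (3 * n + 1) x∈old)) , (λ x∈ws → ∈-++⁺ʳ _ (∈setOf⁻ ws x∈ws)) ]′
                    (x∈p∪q⁻ (vertexSet v n) (setOf ws) x∈)

  edge-before : ∀ j → suc j ≤ k → edge w (suc j) ≡ edge v (suc j)
  edge-before j j<k = edge-suc-cong w v j j λ s _ s≤4 → w-before (s + 3 * j) (≤-trans (+-monoˡ-≤ (3 * j) s≤4) 4+3j≤L)
    where
    4+3j≤L : 4 + 3 * j ≤ L
    4+3j≤L = s≤s (≤-trans (≤-reflexive (sym (*-suc 3 j))) (*-monoʳ-≤ 3 j<k))

  edge-inside : ∀ t → t ≤ suc r →
                edge w (suc (k + t)) ≡ edge4 (sq (3 * t)) (sq (3 * t + 1)) (sq (3 * t + 2)) (sq (3 * t + 3))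
  edge-inside t t≤ = trans (edge-suc w (k + t))
                           (edge4-cong (at 0 z≤n (+-identityʳ (3 * t))) (at 1 (s≤s z≤n) refl) (at 2 (s≤s (s≤s z≤n)) refl) (at 3 ≤-refl refl))
    where
    3t+3≤1+M : 3 * t + 3 ≤ suc M
    3t+3≤1+M = ≤-trans (+-monoˡ-≤ 3 (*-monoʳ-≤ 3 t≤)) (≤-reflexive (last-index r))
      where
      last-index : ∀ r → 3 * suc r + 3 ≡ 6 + 3 * r
      last-index = solve-∀
    at : ∀ s → s ≤ 3 → ∀ {q} → 3 * t + s ≡ q → w (suc s + 3 * (k + t)) ≡ sq q
    at s s≤3 refl = trans (cong w (index k t s)) (w-at (3 * t + s) (≤-trans (+-monoʳ-≤ (3 * t) s≤3) 3t+3≤1+M))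
      where
      index : ∀ k t s → suc s + 3 * (k + t) ≡ suc (3 * k) + (3 * t + s)
      index = solve-∀

  edge-after : ∀ j → suc k + suc r ≤ j → edge w (suc j) ≡ edge v j
  edge-after (suc j) k+r<j = edge-suc-cong w v (suc j) j λ s 1≤s _ →
    trans (w-after (s + 3 * suc j) (L+M<s+3j+3 s 1≤s)) (cong v (trans (cong (_∸ 3) (index s j)) (m+n∸n≡m (s + 3 * j) 3)))
    where
    index : ∀ s j → s + 3 * suc j ≡ s + 3 * j + 3
    index = solve-∀
    L+M≡ : ∀ k r → suc (3 * k) + (3 + (2 + 3 * r)) ≡ 3 * (suc k + suc r)
    L+M≡ = solve-∀
    L+M<s+3j+3 : ∀ s → 1 ≤ s → L + M < s + 3 * suc j
    L+M<s+3j+3 s 1≤s = begin-strict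
      L + M                        ≡⟨ L+M≡ k r ⟩
      3 * (suc k + suc r)          ≤⟨ *-monoʳ-≤ 3 k+r<j ⟩
      3 * suc j                    <⟨ m<n+m (3 * suc j) 1≤s ⟩
      s + 3 * suc j                ∎
      where open ≤-Reasoning

  k≤n : k ≤ n
  k≤n = m+n≤o⇒m≤o k fits

  w-mono : Monochromatic χ red (suc n) w
  w-mono (suc y) _ 1+y≤1+n with suc y ≤? k
  ... | yes y<k = trans (cong χ (edge-before y y<k)) (mono (suc y) (s≤s z≤n) (≤-trans y<k k≤n))
  ... | no  y≮k with m≤n⇒∃[o]m+o≡n (≤-pred (≰⇒> y≮k))
  ...   | t , refl with t ≤? suc r
  ...     | yes t≤ = trans (cong χ (edge-inside t t≤)) (sq-red t t≤)
  ...     | no  t≰ = trans (cong χ (edge-after (k + t) k+r<k+t))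
                           (mono (k + t) (≤-trans (s≤s z≤n) (m≤n⇒m≤o+n k (≰⇒> t≰))) (≤-pred 1+y≤1+n))
    where
    k+r<k+t : suc k + suc r ≤ k + t
    k+r<k+t = ≤-trans (≤-reflexive (sym (+-suc k (suc r)))) (+-monoʳ-≤ k (≰⇒> t≰))

  w-first : firstV w (suc k) ≡ firstV v (suc k)
  w-first = trans (firstV-suc w k) (trans (w-before L ≤-refl) (sym (firstV-suc v k)))

  w-last : suc k + suc r ∸ 1 ≡ n → lastV w (suc k + suc r) ≡ lastV v n
  w-last refl = begin
    w (3 * (suc k + suc r) + 1)  ≡⟨ cong w (end-index k r) ⟩
    w (L + suc M)                ≡⟨ w-at (suc M) ≤-refl ⟩
    sq (suc M)                   ≡⟨ sq-end ⟩
    v (L + (3 + 3 * r))          ≡⟨ cong v (old-end-index k r) ⟩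
    v (3 * (k + suc r) + 1)      ∎
    where
    open ≡-Reasoning
    end-index : ∀ k r → 3 * (suc k + suc r) + 1 ≡ suc (3 * k) + (6 + 3 * r)
    end-index = solve-∀
    old-end-index : ∀ k r → suc (3 * k) + (3 + 3 * r) ≡ 3 * (k + suc r) + 1
    old-end-index = solve-∀

  ¬maximal : ¬ Maximal χ red n v W
  ¬maximal maximal = maximal
    ( setOf ws , suc r , suc k , w
    , (λ x∈ → ws⊆W (∈setOf⁻ ws x∈)) , s≤s z≤n , m+n≤o⇒n≤o k fits , s≤s z≤n
    , ≤-trans (s≤s (m+n≤o⇒m≤o∸n k fits)) (≤-reflexive (+-comm 1 (n ∸ suc r)))
    , w-path , w-mono
    , (λ { (suc j) _ j+1≤k+1 → edge-before j (≤-pred (≤-trans (≤-reflexive (+-comm 1 (suc j))) j+1≤k+1)) })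
    , (λ j k+r≤j _ → edge-after j k+r≤j)
    , w-vertices , (λ _ → w-first) , w-last )

-- Red detours around e_i e_{i+1}

record RedDetour {N} (χ : Colouring N) (v : ℕ → Fin N) (W : Subset N) (u : Fin N) (P : ℕ) : Set where
  field
    x₁ s₁ x₂ s₂ x₃ w₁ w₂ w₃ : Fin N
    interior    : (x₁ ∷ s₁ ∷ x₂ ∷ s₂ ∷ x₃ ∷ []) ↭ (v (1 + P) ∷ v (2 + P) ∷ v (3 + P) ∷ v (4 + P) ∷ v (5 + P) ∷ [])
    ends-in-W   : All (_∈ W) (w₁ ∷ w₂ ∷ w₃ ∷ [])
    ends-unique : Unique (w₁ ∷ w₂ ∷ w₃ ∷ [])
    red₁        : χ (edge4 u w₁ x₁ s₁) ≡ red
    red₂        : χ (edge4 s₁ w₂ x₂ s₂) ≡ red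
    red₃        : χ (edge4 s₂ w₃ x₃ (v (6 + P))) ≡ red

detour-↭ : ∀ {A : Set} (w₁ x₁ s₁ w₂ x₂ s₂ w₃ x₃ : A) →
           (w₁ ∷ x₁ ∷ s₁ ∷ w₂ ∷ x₂ ∷ s₂ ∷ w₃ ∷ x₃ ∷ []) ↭ (x₁ ∷ s₁ ∷ x₂ ∷ s₂ ∷ x₃ ∷ []) ++ (w₁ ∷ w₂ ∷ w₃ ∷ [])
detour-↭ w₁ x₁ s₁ w₂ x₂ s₂ w₃ x₃ = begin
  w₁ ∷ x₁ ∷ s₁ ∷ w₂ ∷ x₂ ∷ s₂ ∷ w₃ ∷ x₃ ∷ []  ↭⟨ prep3 w₁ x₁ s₁ (prep3 w₂ x₂ s₂ (↭-swap w₃ x₃ ↭-refl)) ⟩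
  w₁ ∷ x₁ ∷ s₁ ∷ w₂ ∷ x₂ ∷ s₂ ∷ x₃ ∷ w₃ ∷ []  ↭⟨ prep3 w₁ x₁ s₁ (↭.shift w₂ (x₂ ∷ s₂ ∷ x₃ ∷ []) (w₃ ∷ [])) ⟨
  w₁ ∷ x₁ ∷ s₁ ∷ x₂ ∷ s₂ ∷ x₃ ∷ w₂ ∷ w₃ ∷ []  ↭⟨ ↭.shift w₁ (x₁ ∷ s₁ ∷ x₂ ∷ s₂ ∷ x₃ ∷ []) (w₂ ∷ w₃ ∷ []) ⟨
  x₁ ∷ s₁ ∷ x₂ ∷ s₂ ∷ x₃ ∷ w₁ ∷ w₂ ∷ w₃ ∷ []  ∎
  where
  open PermutationReasoning
  prep3 : ∀ {A : Set} (a b c : A) {xs ys} → xs ↭ ys → a ∷ b ∷ c ∷ xs ↭ a ∷ b ∷ c ∷ ys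
  prep3 a b c = ↭-prep a ∘ ↭-prep b ∘ ↭-prep c

module _ {N} {χ : Colouring N} {n} {v : ℕ → Fin N} {W : Subset N}
  (path : IsLoosePath n v) (mono : Monochromatic χ red n v)
  (W-fresh : ∀ z → z ∈ W → z ∉ vertexSet v n) (maximal : Maximal χ red n v W) where

  ¬detour-from-first : ∀ k → suc k + 1 ≤ n → ¬ RedDetour χ v W (v (suc (3 * k))) (suc (3 * k))
  ¬detour-from-first k fits detour =
    Splice.¬maximal χ n v W path mono W-fresh k 1 (≤-trans (≤-reflexive (+-suc k 1)) fits)
      (w₁ ∷ w₂ ∷ w₃ ∷ []) ends-unique (All.lookup ends-in-W) sq refl refl
      (↭-trans (detour-↭ w₁ x₁ s₁ w₂ x₂ s₂ w₃ x₃) (↭.++⁺ʳ (w₁ ∷ w₂ ∷ w₃ ∷ []) interior))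
      sq-red maximal
    where
    open RedDetour detour
    P = suc (3 * k)
    sq : ℕ → Fin N
    sq 0 = v P
    sq 1 = w₁
    sq 2 = x₁
    sq 3 = s₁
    sq 4 = w₂
    sq 5 = x₂
    sq 6 = s₂
    sq 7 = w₃
    sq 8 = x₃
    sq _ = v (P + 6)
    sq-red : ∀ t → t ≤ 2 → χ (edge4 (sq (3 * t)) (sq (3 * t + 1)) (sq (3 * t + 2)) (sq (3 * t + 3))) ≡ red
    sq-red 0 _ = red₁
    sq-red 1 _ = red₂
    sq-red 2 _ = subst (λ j → χ (edge4 s₂ w₃ x₃ (v j)) ≡ red) (+-comm 6 P) red₃
    sq-red (suc (suc (suc _))) (s≤s (s≤s ()))

  -- u and o are the interior vertices of e_{k+1}, re-read as v_L o v_P u so that the detour can start at u.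
  ¬detour-from-inner : ∀ k → suc (suc k) + 1 ≤ n → ∀ {u o} →
                       (o ∷ u ∷ []) ↭ (v (2 + 3 * k) ∷ v (3 + 3 * k) ∷ []) → ¬ RedDetour χ v W u (4 + 3 * k)
  ¬detour-from-inner k fits {u} {o} o,u↭ detour =
    Splice.¬maximal χ n v W path mono W-fresh k 2 (≤-trans (≤-reflexive k+3≡) fits)
      (w₁ ∷ w₂ ∷ w₃ ∷ []) ends-unique (All.lookup ends-in-W) sq refl refl
      (↭.++⁺ reordered (↭-trans (detour-↭ w₁ x₁ s₁ w₂ x₂ s₂ w₃ x₃) (↭.++⁺ʳ (w₁ ∷ w₂ ∷ w₃ ∷ []) interior)))
      sq-red maximal
    where
    open RedDetour detour
    L = suc (3 * k)
    P = 3 + L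
    k+3≡ : k + 3 ≡ suc (suc k) + 1
    k+3≡ = trans (+-suc k 2) (cong suc (+-suc k 1))
    reordered : (o ∷ v P ∷ u ∷ []) ↭ (v (1 + L) ∷ v (2 + L) ∷ v P ∷ [])
    reordered = ↭-trans (↭-prep o (↭-swap (v P) u ↭-refl)) (↭.++⁺ʳ (v P ∷ []) o,u↭)
    sq : ℕ → Fin N
    sq 0  = v L
    sq 1  = o
    sq 2  = v P
    sq 3  = u
    sq 4  = w₁
    sq 5  = x₁
    sq 6  = s₁
    sq 7  = w₂
    sq 8  = x₂
    sq 9  = s₂
    sq 10 = w₃
    sq 11 = x₃
    sq _  = v (L + 9)
    sq-red : ∀ t → t ≤ 3 → χ (edge4 (sq (3 * t)) (sq (3 * t + 1)) (sq (3 * t + 2)) (sq (3 * t + 3))) ≡ red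
    sq-red 0 _ = begin
      χ (edge4 (v L) o (v P) u)                          ≡⟨ cong χ (edge4-↭ (↭-prep (v L) reordered)) ⟩
      χ (edge4 (v L) (v (1 + L)) (v (2 + L)) (v P))      ≡⟨ cong χ (edge-suc v k) ⟨
      χ (edge v (suc k))                                 ≡⟨ mono (suc k) (s≤s z≤n) (≤-trans (n≤1+n (suc k)) (m+n≤o⇒m≤o (suc (suc k)) fits)) ⟩
      red                                                ∎
      where open ≡-Reasoning
    sq-red 1 _ = red₁
    sq-red 2 _ = red₂
    sq-red 3 _ = subst (λ j → χ (edge4 s₂ w₃ x₃ (v j)) ≡ red) (last-index k) red₃
      where
      last-index : ∀ k → 6 + (3 + suc (3 * k)) ≡ suc (3 * k) + 9
      last-index = solve-∀
    sq-red (suc (suc (suc (suc _)))) (s≤s (s≤s (s≤s ())))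

  ¬detour : ∀ k → suc k + 1 ≤ n → ∀ {u} → u ∈ A v (suc k) → ¬ RedDetour χ v W u (suc (3 * k))
  ¬detour zero fits u∈A rewrite x∈⁅y⁆⇒x≡y _ u∈A = ¬detour-from-first 0 fits
  ¬detour (suc k) fits {u} u∈A with x∈p─q⁻ (edge v (suc k)) _ u∈A
  ... | u∈e , u≢first with ∈edge4⁻ (subst (u ∈_) (edge-suc v k) u∈e)
  ... | inj₁ refl               = ⊥-elim (u≢first (subst (λ z → v (1 + 3 * k) ∈ ⁅ z ⁆) (sym (firstV-suc v k)) (x∈⁅x⁆ _)))
  ... | inj₂ (inj₁ refl)        = subst (¬_ ∘ RedDetour χ v W u) (sym (1+3[1+k]≡4+3k k)) (¬detour-from-inner k fits (↭-swap _ _ ↭-refl))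
  ... | inj₂ (inj₂ (inj₁ refl)) = subst (¬_ ∘ RedDetour χ v W u) (sym (1+3[1+k]≡4+3k k)) (¬detour-from-inner k fits ↭-refl)
  ... | inj₂ (inj₂ (inj₂ refl)) = subst (λ j → ¬ RedDetour χ v W (v j) (suc (3 * suc k))) (1+3[1+k]≡4+3k k) (¬detour-from-first (suc k) fits)

-- Good configurations from small triples of labels

isRed : Colour → Bool
isRed red  = true
isRed blue = false

module EndColours {N} (χ : Colouring N) (W : Subset N) where

  redEnds blueEnds : Subset N → Subset N
  redEnds T  = W ∩ tabulate (λ w → isRed (χ (⁅ w ⁆ ∪ T)))
  blueEnds T = W ─ redEnds T

  ∈redEnds⁻ : ∀ T {w} → w ∈ redEnds T → w ∈ W × χ (⁅ w ⁆ ∪ T) ≡ red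
  ∈redEnds⁻ T {w} w∈ with x∈p∩q⁻ W _ w∈
  ... | w∈W , w∈red with χ (⁅ w ⁆ ∪ T) in colour
  ... | red  = w∈W , refl
  ... | blue = ⊥-elim (true≢false (trans (sym ([]=⇒lookup w∈red)) (trans (lookup∘tabulate _ w) (cong isRed colour))))
    where
    true≢false : true ≢ false
    true≢false ()

  ∈blueEnds⁻ : ∀ T {w} → w ∈ blueEnds T → w ∈ W × χ (⁅ w ⁆ ∪ T) ≡ blue
  ∈blueEnds⁻ T {w} w∈ with x∈p─q⁻ W (redEnds T) w∈
  ... | w∈W , w∉red with χ (⁅ w ⁆ ∪ T) in colour
  ... | blue = w∈W , refl
  ... | red  = ⊥-elim (w∉red (x∈p∩q⁺ (w∈W , lookup⇒[]= w _ (trans (lookup∘tabulate _ w) (cong isRed colour)))))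

  ∣W∣≤∣blueEnds∣+∣redEnds∣ : ∀ T → ∣ W ∣ ≤ ∣ blueEnds T ∣ + ∣ redEnds T ∣
  ∣W∣≤∣blueEnds∣+∣redEnds∣ T = ≤-trans (p⊆q⇒∣p∣≤∣q∣ W⊆blue∪red) (∣p∪q∣≤∣p∣+∣q∣ (blueEnds T) (redEnds T))
    where
    W⊆blue∪red : W ⊆ blueEnds T ∪ redEnds T
    W⊆blue∪red {w} w∈W with w ∈? redEnds T
    ... | yes w∈red = x∈p∪q⁺ (inj₂ w∈red)
    ... | no  w∉red = x∈p∪q⁺ (inj₁ (x∈p∧x∉q⇒x∈p─q w∈W w∉red))

  ∣W∣≤∣blueEnds∣+2 : ∀ T → ∣ redEnds T ∣ ≤ 2 → ∣ W ∣ ≤ ∣ blueEnds T ∣ + 2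
  ∣W∣≤∣blueEnds∣+2 T small = ≤-trans (∣W∣≤∣blueEnds∣+∣redEnds∣ T) (+-monoʳ-≤ _ small)

  2≤∣blueEnds∣ : 4 ≤ ∣ W ∣ → ∀ T → ∣ redEnds T ∣ ≤ 2 → 2 ≤ ∣ blueEnds T ∣
  2≤∣blueEnds∣ 4≤∣W∣ T small = +-cancelʳ-≤ 2 2 _ (≤-trans 4≤∣W∣ (∣W∣≤∣blueEnds∣+2 T small))

RobustGoodConfig : ∀ {N} → Colouring N → ℕ → (ℕ → Fin N) → Subset N → ℕ → Fin N → Set
RobustGoodConfig {N} χ n v W i u =
  Σ (Fin N) λ x → Σ (Fin N) λ a1 → Σ (Fin N) λ a2 → Σ (Fin N) λ a3 →
  Σ (Fin N) λ a4 → Σ (Fin N) λ a5 → Σ (Fin N) λ y → Σ (Fin N) λ v′ →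
    GoodConfig χ blue n v W x a1 a2 a3 a4 a5 y ×
    v′ ∈ A v (i + 2) ×
    Sset a1 a2 a3 a4 a5 ⊆ ((edge v i ─ ⁅ firstV v i ⁆) ∪ ⁅ u ⁆) ∪ (edge v (i + 1) ─ ⁅ v′ ⁆) ×
    Σ (Subset N) λ W₁ → Σ (Subset N) λ W₂ →
      W₁ ⊆ W × W₂ ⊆ W × ∣ W ∣ ≤ ∣ W₁ ∣ + 2 × ∣ W ∣ ≤ ∣ W₂ ∣ + 3 ×
      (∀ x′ y′ → x′ ∈ W₁ → y′ ∈ W₂ → x′ ≢ y′ → GoodConfig χ blue n v W x′ a1 a2 a3 a4 a5 y′)

Label : Set
Label = Fin 7

pattern U = fzero
pattern B = fsuc fzero
pattern C = fsuc (fsuc fzero)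
pattern D = fsuc (fsuc (fsuc fzero))
pattern E = fsuc (fsuc (fsuc (fsuc fzero)))
pattern F = fsuc (fsuc (fsuc (fsuc (fsuc fzero))))
pattern G = fsuc (fsuc (fsuc (fsuc (fsuc (fsuc fzero)))))

labels-↭ : {as bs : List Label} → sort as ≡ sort bs → as ↭ bs
labels-↭ {as} {bs} sorted = ↭-trans (↭-sym (sort-↭ as)) (subst (_↭ bs) (sym sorted) (sort-↭ bs))

module Configurations {N} (χ : Colouring N) (n : ℕ) (v : ℕ → Fin N) (W : Subset N)
  (path : IsLoosePath n v) (W-fresh : ∀ z → z ∈ W → z ∉ vertexSet v n) (4≤∣W∣ : 4 ≤ ∣ W ∣)
  (k : ℕ) (fits : suc k + 1 ≤ n) (u : Fin N) (u∈A : u ∈ A v (suc k))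
  (¬detour : ¬ RedDetour χ v W u (suc (3 * k)))
  where

  open EndColours χ W

  P : ℕ
  P = suc (3 * k)

  6+P≤ : 6 + P ≤ 3 * n + 1
  6+P≤ = ≤-trans (≤-reflexive (7+3k≡ k)) (+-monoˡ-≤ 1 (*-monoʳ-≤ 3 fits))
    where
    7+3k≡ : ∀ k → 6 + suc (3 * k) ≡ 3 * (suc k + 1) + 1
    7+3k≡ = solve-∀

  v-≢ : ∀ {a b} → 1 ≤ b → b < a → a ≤ 3 * n + 1 → v a ≢ v b
  v-≢ 1≤b b<a a≤ va≡vb = <⇒≢ b<a (sym (path _ _ (≤-trans 1≤b (<⇒≤ b<a)) a≤ 1≤b (≤-trans (<⇒≤ b<a) a≤) va≡vb))

  v-offset-≢ : ∀ {i j} → i < j → j ≤ 6 → v (j + P) ≢ v (i + P)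
  v-offset-≢ {i} i<j j≤6 = v-≢ (≤-trans (s≤s z≤n) (m≤n+m P i)) (+-monoˡ-< P i<j) (≤-trans (+-monoˡ-≤ P j≤6) 6+P≤)

  -- U is u, and B, …, G are the vertices v_{P+1}, …, v_{P+6} following the first vertex v_P of e_{k+1}.
  val : Label → Fin N
  val U          = u
  val a@(fsuc _) = v (toℕ a + P)

  offset≤ : ∀ (a : Label) → toℕ a + P ≤ 3 * n + 1
  offset≤ a = ≤-trans (+-monoˡ-≤ P (Fin.toℕ≤pred[n] a)) 6+P≤

  u-position : ∃[ q ] 0 < q × q ≤ P × v q ≡ u
  u-position = ∈points⁻ v P (A⊆points v k u∈A)

  val-≢-prefix : ∀ a → a ≢ U → ∀ {q} → 1 ≤ q → q ≤ P → val a ≢ v q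
  val-≢-prefix U          a≢U = ⊥-elim (a≢U refl)
  val-≢-prefix a@(fsuc _) _ 1≤q q≤P = v-≢ 1≤q (≤-trans (s≤s q≤P) (+-monoˡ-≤ P (s≤s z≤n))) (offset≤ a)

  val-injective : ∀ {a b} → val a ≡ val b → a ≡ b
  val-injective {U}          {U}          _  = refl
  val-injective {U}          {b@(fsuc _)} eq with u-position
  ... | q , 1≤q , q≤P , vq≡u = ⊥-elim (val-≢-prefix b (λ ()) 1≤q q≤P (trans (sym eq) (sym vq≡u)))
  val-injective {a@(fsuc _)} {U}          eq = sym (val-injective {U} {a} (sym eq))
  val-injective {a@(fsuc _)} {b@(fsuc _)} eq =
    Fin.toℕ-injective (+-cancelʳ-≡ P _ _ (path _ _ (s≤s z≤n) (offset≤ a) (s≤s z≤n) (offset≤ b) eq))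

  val∉W : ∀ a → val a ∉ W
  val∉W a val∈W = W-fresh _ val∈W (val∈V a)
    where
    val∈V : ∀ a → val a ∈ vertexSet v n
    val∈V U with u-position
    ... | q , 1≤q , q≤P , vq≡u = subst (_∈ vertexSet v n) vq≡u (∈points⁺ v _ q 1≤q (≤-trans q≤P (≤-trans (m≤n+m P 6) 6+P≤)))
    val∈V a@(fsuc _) = ∈points⁺ v _ _ (s≤s z≤n) (offset≤ a)

  val∉A : ∀ a → a ≢ U → val a ∉ A v (suc k)
  val∉A a a≢U val∈A with ∈points⁻ v P (A⊆points v k val∈A)
  ... | q , 1≤q , q≤P , vq≡val = val-≢-prefix a a≢U 1≤q q≤P (sym vq≡val)

  in-current : ∀ {z} → z ≡ v P ⊎ z ≡ v (1 + P) ⊎ z ≡ v (2 + P) ⊎ z ≡ v (3 + P) → z ∈ edge v (suc k)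
  in-current = subst (_ ∈_) (sym (edge-suc v k)) ∘ ∈edge4⁺

  in-next : ∀ {z} → z ≡ v (3 + P) ⊎ z ≡ v (4 + P) ⊎ z ≡ v (5 + P) ⊎ z ≡ v (6 + P) → z ∈ edge v (suc k + 1)
  in-next = subst (_ ∈_) (sym (edge-next v k)) ∘ ∈edge4⁺

  data Zone : Label → Set where
    anchor : Zone U
    inner  : ∀ {a} → val a ∈ edge v (suc k) ─ ⁅ firstV v (suc k) ⁆ → Zone a
    outer  : ∀ {a} → val a ∈ edge v (suc k + 1) → Zone a

  inner-of : ∀ a → a ≢ U → val a ∈ edge v (suc k) → Zone a
  inner-of a a≢U a∈e = inner (x∈p∧x∉q⇒x∈p─q a∈e λ a∈first →
    val-≢-prefix a a≢U (s≤s z≤n) ≤-refl (trans (x∈⁅y⁆⇒x≡y _ a∈first) (firstV-suc v k)))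

  zone : ∀ a → Zone a
  zone U = anchor
  zone B = inner-of B (λ ()) (in-current (inj₂ (inj₁ refl)))
  zone C = inner-of C (λ ()) (in-current (inj₂ (inj₂ (inj₁ refl))))
  zone D = inner-of D (λ ()) (in-current (inj₂ (inj₂ (inj₂ refl))))
  zone E = outer (in-next (inj₂ (inj₁ refl)))
  zone F = outer (in-next (inj₂ (inj₂ (inj₁ refl))))
  zone G = outer (in-next (inj₂ (inj₂ (inj₂ refl))))

  late-∈next : ∀ g → 4 ≤ toℕ g → val g ∈ edge v (suc k + 1)
  late-∈next E _ = in-next (inj₂ (inj₁ refl))
  late-∈next F _ = in-next (inj₂ (inj₂ (inj₁ refl)))
  late-∈next G _ = in-next (inj₂ (inj₂ (inj₂ refl)))
  late-∈next U ()
  late-∈next B (s≤s ())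
  late-∈next C (s≤s (s≤s ()))
  late-∈next D (s≤s (s≤s (s≤s ())))

  late-∉current : ∀ g → 4 ≤ toℕ g → val g ∉ edge v (suc k)
  late-∉current U ()
  late-∉current g@(fsuc _) 4≤g val∈ with ∈edge4⁻ (subst (val g ∈_) (edge-suc v k) val∈)
  ... | inj₁ eq               = v-offset-≢ {0} (≤-trans (s≤s z≤n) 4≤g) (Fin.toℕ≤pred[n] g) eq
  ... | inj₂ (inj₁ eq)        = v-offset-≢ {1} (≤-trans (s≤s (s≤s z≤n)) 4≤g) (Fin.toℕ≤pred[n] g) eq
  ... | inj₂ (inj₂ (inj₁ eq)) = v-offset-≢ {2} (≤-trans (s≤s (s≤s (s≤s z≤n))) 4≤g) (Fin.toℕ≤pred[n] g) eq
  ... | inj₂ (inj₂ (inj₂ eq)) = v-offset-≢ {3} 4≤g (Fin.toℕ≤pred[n] g) eq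

  late-∈A : ∀ g → 4 ≤ toℕ g → val g ∈ A v (suc k + 2)
  late-∈A U ()
  late-∈A g@(fsuc _) 4≤g = subst (val g ∈_) (sym (A-next v k))
    (x∈p∧x∉q⇒x∈p─q (late-∈next g 4≤g) λ val∈ → v-offset-≢ {3} 4≤g (Fin.toℕ≤pred[n] g) (x∈⁅y⁆⇒x≡y _ val∈))

  -- Sorting makes ⟦_⟧, hence Small, invariant under reordering of concrete label lists by computation.
  ⟦_⟧ : List Label → Subset N
  ⟦ as ⟧ = setOf (map val (sort as))

  ⟦⟧≡setOf : ∀ as → ⟦ as ⟧ ≡ setOf (map val as)
  ⟦⟧≡setOf as = setOf-↭ (↭.map⁺ val (sort-↭ as))

  edge-via-labels : ∀ x a b c → edge4 x (val a) (val b) (val c) ≡ ⁅ x ⁆ ∪ ⟦ a ∷ b ∷ c ∷ [] ⟧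
  edge-via-labels x a b c = trans (edge4≡setOf x _ _ _) (cong (⁅ x ⁆ ∪_) (sym (⟦⟧≡setOf (a ∷ b ∷ c ∷ []))))

  edge-colour : ∀ {col} x a b c → χ (⁅ x ⁆ ∪ ⟦ a ∷ b ∷ c ∷ [] ⟧) ≡ col → χ (edge4 x (val a) (val b) (val c)) ≡ col
  edge-colour x a b c = trans (cong χ (edge-via-labels x a b c))

  Small : List Label → Set
  Small as = ∣ redEnds ⟦ as ⟧ ∣ ≤ 2

  data SmallOnDetour (as bs cs : List Label) : Set where
    first  : Small as → SmallOnDetour as bs cs
    second : Small bs → SmallOnDetour as bs cs
    third  : Small cs → SmallOnDetour as bs cs

  small? : ∀ as → Dec (Small as)
  small? as = ∣ redEnds ⟦ as ⟧ ∣ ≤? 2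

  detour-of-large : ∀ x₁ s₁ x₂ s₂ x₃ → (x₁ ∷ s₁ ∷ x₂ ∷ s₂ ∷ x₃ ∷ []) ↭ (B ∷ C ∷ D ∷ E ∷ F ∷ []) →
                    ¬ Small (U ∷ x₁ ∷ s₁ ∷ []) → ¬ Small (s₁ ∷ x₂ ∷ s₂ ∷ []) → ¬ Small (s₂ ∷ x₃ ∷ G ∷ []) →
                    RedDetour χ v W u P
  detour-of-large x₁ s₁ x₂ s₂ x₃ σ large₁ large₂ large₃
    with ∃∈p∉ₗ (redEnds ⟦ U ∷ x₁ ∷ s₁ ∷ [] ⟧) [] (≤-trans (s≤s z≤n) (≰⇒> large₁))
  ... | w₁ , w₁∈ , _
    with ∃∈p∉ₗ (redEnds ⟦ s₁ ∷ x₂ ∷ s₂ ∷ [] ⟧) (w₁ ∷ []) (≤-trans (s≤s (s≤s z≤n)) (≰⇒> large₂))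
  ... | w₂ , w₂∈ , w₂∉
    with ∃∈p∉ₗ (redEnds ⟦ s₂ ∷ x₃ ∷ G ∷ [] ⟧) (w₁ ∷ w₂ ∷ []) (≰⇒> large₃)
  ... | w₃ , w₃∈ , w₃∉ = record
    { x₁ = val x₁ ; s₁ = val s₁ ; x₂ = val x₂ ; s₂ = val s₂ ; x₃ = val x₃
    ; w₁ = w₁ ; w₂ = w₂ ; w₃ = w₃
    ; interior    = ↭.map⁺ val σ
    ; ends-in-W   = proj₁ (∈redEnds⁻ _ w₁∈) ∷ proj₁ (∈redEnds⁻ _ w₂∈) ∷ proj₁ (∈redEnds⁻ _ w₃∈) ∷ []
    ; ends-unique = ((λ eq → w₂∉ (here (sym eq))) ∷ (λ eq → w₃∉ (here (sym eq))) ∷ [])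
                  ∷ ((λ eq → w₃∉ (there (here (sym eq)))) ∷ []) ∷ [] ∷ []
    ; red₁ = red-edge U x₁ s₁ w₁∈
    ; red₂ = red-edge s₁ x₂ s₂ w₂∈
    ; red₃ = red-edge s₂ x₃ G w₃∈
    }
    where
    red-edge : ∀ a b c {w} → w ∈ redEnds ⟦ a ∷ b ∷ c ∷ [] ⟧ → χ (edge4 (val a) w (val b) (val c)) ≡ red
    red-edge a b c {w} w∈ =
      trans (cong χ (edge4-↭ (↭.swap (val a) w ↭.refl))) (edge-colour w a b c (proj₂ (∈redEnds⁻ _ w∈)))

  small-on-detour : ∀ x₁ s₁ x₂ s₂ x₃ → (x₁ ∷ s₁ ∷ x₂ ∷ s₂ ∷ x₃ ∷ []) ↭ (B ∷ C ∷ D ∷ E ∷ F ∷ []) →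
                    SmallOnDetour (U ∷ x₁ ∷ s₁ ∷ []) (s₁ ∷ x₂ ∷ s₂ ∷ []) (s₂ ∷ x₃ ∷ G ∷ [])
  small-on-detour x₁ s₁ x₂ s₂ x₃ σ
    with small? (U ∷ x₁ ∷ s₁ ∷ []) | small? (s₁ ∷ x₂ ∷ s₂ ∷ []) | small? (s₂ ∷ x₃ ∷ G ∷ [])
  ... | yes small | _         | _         = first small
  ... | no _      | yes small | _         = second small
  ... | no _      | no _      | yes small = third small
  ... | no large₁ | no large₂ | no large₃ = ⊥-elim (¬detour (detour-of-large x₁ s₁ x₂ s₂ x₃ σ large₁ large₂ large₃))

  window-of : ∀ a → val a ∈ A v (suc k) ∪ (edge v (suc k) ∪ edge v (suc k + 1))
  window-of a with zone a
  ... | anchor    = x∈p∪q⁺ (inj₁ u∈A)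
  ... | inner a∈e = x∈p∪q⁺ (inj₂ (x∈p∪q⁺ (inj₁ (p─q⊆p _ _ a∈e))))
  ... | outer a∈e = x∈p∪q⁺ (inj₂ (x∈p∪q⁺ (inj₂ a∈e)))

  target-of : ∀ a g → g ≢ a →
              val a ∈ ((edge v (suc k) ─ ⁅ firstV v (suc k) ⁆) ∪ ⁅ u ⁆) ∪ (edge v (suc k + 1) ─ ⁅ val g ⁆)
  target-of a g g≢a with zone a
  ... | anchor    = x∈p∪q⁺ (inj₁ (x∈p∪q⁺ (inj₂ (x∈⁅x⁆ u))))
  ... | inner a∈e = x∈p∪q⁺ (inj₁ (x∈p∪q⁺ (inj₁ a∈e)))
  ... | outer a∈e = x∈p∪q⁺ (inj₂ (x∈p∧x∉q⇒x∈p─q a∈e λ a∈g → g≢a (val-injective (sym (x∈⁅y⁆⇒x≡y _ a∈g)))))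

  A-anchor : ∀ a → val a ∈ A v (suc k) → val a ∈ ⁅ u ⁆
  A-anchor U          _     = x∈⁅x⁆ u
  A-anchor a@(fsuc _) val∈A = ⊥-elim (val∉A a (λ ()) val∈A)

  ∈Sset-val⁻ : ∀ a₁ a₂ a₃ a₄ a₅ {z} → z ∈ Sset (val a₁) (val a₂) (val a₃) (val a₄) (val a₅) →
               ∃[ a ] a ∈ₗ (a₁ ∷ a₂ ∷ a₃ ∷ a₄ ∷ a₅ ∷ []) × z ≡ val a
  ∈Sset-val⁻ a₁ a₂ a₃ a₄ a₅ = ∈-map⁻ val ∘ ∈Sset⁻ (val a₁) (val a₂) (val a₃) (val a₄) (val a₅)

  Sset-val-⊆ : ∀ a₁ a₂ a₃ a₄ a₅ {X : Subset N} → (∀ {a} → a ∈ₗ (a₁ ∷ a₂ ∷ a₃ ∷ a₄ ∷ a₅ ∷ []) → val a ∈ X) →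
               Sset (val a₁) (val a₂) (val a₃) (val a₄) (val a₅) ⊆ X
  Sset-val-⊆ a₁ a₂ a₃ a₄ a₅ all-in z∈S with ∈Sset-val⁻ a₁ a₂ a₃ a₄ a₅ z∈S
  ... | a , a∈as , refl = all-in a∈as

  blue-config : ∀ (a₁ a₂ a₃ a₄ a₅ g : Label) → Unique (g ∷ a₁ ∷ a₂ ∷ a₃ ∷ a₄ ∷ a₅ ∷ []) → 4 ≤ toℕ g →
                ∀ {x y} → x ∈ W → y ∈ W → x ≢ y →
                χ (edge4 x (val a₁) (val a₂) (val a₃)) ≡ blue → χ (edge4 (val a₃) (val a₄) (val a₅) y) ≡ blue →
                GoodConfigAt χ blue n v W (suc k) x (val a₁) (val a₂) (val a₃) (val a₄) (val a₅) y
  blue-config a₁ a₂ a₃ a₄ a₅ g distinct 4≤g x∈W y∈W x≢y blue₁ blue₂ =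
    unique-between (map val as) (Unique.map⁺ (λ {a} {b} → val-injective {a} {b}) (tail distinct))
                   (All.map⁺ (All.universal val∉W as)) x∈W y∈W x≢y ,
    x∈W , y∈W , blue₁ , blue₂ , s≤s z≤n , fits ,
    Sset-val-⊆ a₁ a₂ a₃ a₄ a₅ (λ {a} _ → window-of a) ,
    ≤-trans (p⊆q⇒∣p∣≤∣q∣ S∩A⊆⁅u⁆) (≤-reflexive (∣⁅x⁆∣≡1 u)) ,
    val g , late-∈next g 4≤g , late-∉current g 4≤g , g∉S
    where
    as : List Label
    as = a₁ ∷ a₂ ∷ a₃ ∷ a₄ ∷ a₅ ∷ []
    S : Subset N
    S = Sset (val a₁) (val a₂) (val a₃) (val a₄) (val a₅)
    S∩A⊆⁅u⁆ : S ∩ A v (suc k) ⊆ ⁅ u ⁆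
    S∩A⊆⁅u⁆ z∈ with x∈p∩q⁻ S _ z∈
    ... | z∈S , z∈A with ∈Sset-val⁻ a₁ a₂ a₃ a₄ a₅ z∈S
    ... | a , _ , refl = A-anchor a z∈A
    g∉S : val g ∉ S
    g∉S g∈S with ∈Sset-val⁻ a₁ a₂ a₃ a₄ a₅ g∈S
    ... | a , a∈as , g≡a = All.lookup (head distinct) a∈as (val-injective g≡a)

  good-pair : ∀ (a₁ a₂ a₃ a₄ a₅ g : Label) →
              {distinct : True (unique? (g ∷ a₁ ∷ a₂ ∷ a₃ ∷ a₄ ∷ a₅ ∷ []))} {late : True (4 ≤? toℕ g)} →
              Small (a₁ ∷ a₂ ∷ a₃ ∷ []) → Small (a₃ ∷ a₄ ∷ a₅ ∷ []) → RobustGoodConfig χ n v W (suc k) u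
  good-pair a₁ a₂ a₃ a₄ a₅ g {distinct} {late} small₁ small₂
    with ∃∈p∉ₗ (blueEnds ⟦ a₃ ∷ a₄ ∷ a₅ ∷ [] ⟧) [] (≤-trans (s≤s z≤n) (2≤∣blueEnds∣ 4≤∣W∣ _ small₂))
  ... | y , y∈W₂ , _
    with ∃∈p∉ₗ (blueEnds ⟦ a₁ ∷ a₂ ∷ a₃ ∷ [] ⟧) (y ∷ []) (2≤∣blueEnds∣ 4≤∣W∣ _ small₁)
  ... | x , x∈W₁ , x∉[y] =
    x , val a₁ , val a₂ , val a₃ , val a₄ , val a₅ , y , val g ,
    (1 + k , config x∈W₁ y∈W₂ (x∉[y] ∘ here)) , late-∈A g (toWitness late) ,
    Sset-val-⊆ a₁ a₂ a₃ a₄ a₅ (λ {a} a∈as → target-of a g (All.lookup (head (toWitness distinct)) a∈as)) ,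
    W₁ , W₂ , (λ w∈ → proj₁ (∈blueEnds⁻ T₁ w∈)) , (λ w∈ → proj₁ (∈blueEnds⁻ T₂ w∈)) ,
    ∣W∣≤∣blueEnds∣+2 T₁ small₁ , ≤-trans (∣W∣≤∣blueEnds∣+2 T₂ small₂) (+-monoʳ-≤ ∣ W₂ ∣ (n≤1+n 2)) ,
    λ x′ y′ x′∈ y′∈ x′≢y′ → 1 + k , config x′∈ y′∈ x′≢y′
    where
    T₁ T₂ W₁ W₂ : Subset N
    T₁ = ⟦ a₁ ∷ a₂ ∷ a₃ ∷ [] ⟧
    T₂ = ⟦ a₃ ∷ a₄ ∷ a₅ ∷ [] ⟧
    W₁ = blueEnds T₁
    W₂ = blueEnds T₂
    config : ∀ {x y} → x ∈ W₁ → y ∈ W₂ → x ≢ y →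
             GoodConfigAt χ blue n v W (suc k) x (val a₁) (val a₂) (val a₃) (val a₄) (val a₅) y
    config {x} {y} x∈W₁ y∈W₂ x≢y =
      blue-config a₁ a₂ a₃ a₄ a₅ g (toWitness distinct) (toWitness late)
        (proj₁ (∈blueEnds⁻ T₁ x∈W₁)) (proj₁ (∈blueEnds⁻ T₂ y∈W₂)) x≢y
        (edge-colour x a₁ a₂ a₃ (proj₂ (∈blueEnds⁻ T₁ x∈W₁)))
        (trans (cong χ (edge4-↭ (↭.shift y (val a₃ ∷ val a₄ ∷ val a₅ ∷ []) [])))
               (edge-colour y a₃ a₄ a₅ (proj₂ (∈blueEnds⁻ T₂ y∈W₂))))

  -- One clause per compatible pair of small triples: that this table covers every choice of
  -- one small triple per detour is the finite case check.
  configuration : RobustGoodConfig χ n v W (suc k) u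
  configuration with small-on-detour C E D B F (labels-↭ refl) | small-on-detour D B E C F (labels-↭ refl)
                   | small-on-detour E B F D C (labels-↭ refl) | small-on-detour B F C E D (labels-↭ refl)
  ... | first UCE  | _          | third CDG  | _          = good-pair U E C D G F UCE CDG
  ... | second BDE | _          | third CDG  | _          = good-pair E B D C G F BDE CDG
  ... | third BFG  | _          | third CDG  | _          = good-pair B F G D C E BFG CDG
  ... | first UCE  | _          | _          | first UBF  = good-pair B F U C E G UBF UCE
  ... | second BDE | _          | _          | first UBF  = good-pair U F B D E G UBF BDE
  ... | third BFG  | first UBD  | _          | first UBF  = good-pair U D B F G E UBD BFG
  ... | third _    | second BCE | _          | first UBF  = good-pair U F B C E G UBF BCE
  ... | third _    | third CFG  | _          | first UBF  = good-pair U B F C G E UBF CFG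
  ... | _          | _          | first UBE  | second CEF = good-pair U B E C F G UBE CEF
  ... | _          | _          | second BDF | second CEF = good-pair B D F C E G BDF CEF
  ... | _          | _          | first UBE  | third DEG  = good-pair U B E D G F UBE DEG
  ... | _          | first UBD  | second _   | third DEG  = good-pair U B D E G F UBD DEG
  ... | _          | second BCE | second _   | third DEG  = good-pair B C E D G F BCE DEG
  ... | _          | third CFG  | second BDF | third DEG  = good-pair B D F C G E BDF CFG

lemma2 : (N : ℕ) (χ : Colouring N) (n : ℕ) (v : ℕ → Fin N) (W : Subset N) →
    IsLoosePath n v → Monochromatic χ red n v →
    (∀ z → z ∈ W → z ∉ vertexSet v n) → 4 ≤ ∣ W ∣ →
    Maximal χ red n v W →
    ∀ i → 1 ≤ i → i + 1 ≤ n → ∀ u → u ∈ A v i →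
    Σ (Fin N) λ x → Σ (Fin N) λ a1 → Σ (Fin N) λ a2 → Σ (Fin N) λ a3 →
    Σ (Fin N) λ a4 → Σ (Fin N) λ a5 → Σ (Fin N) λ y → Σ (Fin N) λ v′ →
      GoodConfig χ blue n v W x a1 a2 a3 a4 a5 y ×
      v′ ∈ A v (i + 2) ×
      Sset a1 a2 a3 a4 a5 ⊆
        ((edge v i ─ ⁅ firstV v i ⁆) ∪ ⁅ u ⁆) ∪ (edge v (i + 1) ─ ⁅ v′ ⁆) ×
      Σ (Subset N) λ W₁ → Σ (Subset N) λ W₂ →
        W₁ ⊆ W × W₂ ⊆ W × ∣ W ∣ ≤ ∣ W₁ ∣ + 2 × ∣ W ∣ ≤ ∣ W₂ ∣ + 3 ×
        (∀ x′ y′ → x′ ∈ W₁ → y′ ∈ W₂ → x′ ≢ y′ →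
          GoodConfig χ blue n v W x′ a1 a2 a3 a4 a5 y′)
lemma2 N χ n v W path mono W-fresh 4≤∣W∣ maximal zero () _ _ _
lemma2 N χ n v W path mono W-fresh 4≤∣W∣ maximal (suc k) _ fits u u∈A =
  Configurations.configuration χ n v W path W-fresh 4≤∣W∣ k fits u u∈A
    (¬detour path mono W-fresh maximal k fits u∈A)
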